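{- Let $n\ge 0$ and $k\ge 0$ be integers. Let $\overline{RD}_{n+2,k}$ be the set of permutations $\pi\in\mathcal{Q}_{n+2}$ with $\mathrm{des}(\pi)=k$ such that, with $a=\pi^{ -1}(1)$, either $a=n+2$, or $2\le a\le n+1$ and $\pi(a-1)<\pi(a+1)$. Let $RHD_{n+1,k-1}$ be the set of pairs $[\sigma,i]$ with $\sigma\in\mathcal{Q}_{n+1}$, $\mathrm{des}(\sigma)=k-1$, $i\in\{1,2,\dots,n-k+2\}$ and $i>\sigma^{ -1}(n+1)-1$. Then there is a bijection from $\overline{RD}_{n+2,k}$ onto $RHD_{n+1,k-1}$.
   Context: Permutations of $[m]=\{1,\dots,m\}$ are written as words $\pi(1)\cdots\pi(m)$. A descent of $\pi$ is an index $i\in[m-1]$ with $\pi(i)>\pi(i+1)$; $\mathrm{des}(\pi)$ is the number of descents. $\mathcal{Q}_m$ denotes the set of permutations $\pi$ of $[m]$ such that $\pi(1)<\pi(2)<\cdots<\pi(p)$ where $p=\pi^{ -1}(m)$ (the identity permutation being included). -}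

module Defs where

open import Data.Nat using (ℕ; zero; suc; _+_; _∸_; _≤_; _<_; _≡ᵇ_; _<ᵇ_)
open import Data.Bool using (if_then_else_)
open import Data.List using (List; []; _∷_; take; map; upTo)
open import Data.List.Relation.Unary.Linked using (Linked)
open import Data.List.Relation.Binary.Permutation.Propositional using (_↭_)
open import Data.Product using (Σ; _×_; _,_; proj₁)
open import Data.Sum using (_⊎_)
open import Relation.Binary.PropositionalEquality using (_≡_)
open import Relation.Binary.Bundles using (Setoid)
import Relation.Binary.PropositionalEquality as P
import Relation.Binary.Construct.On as On

-- A permutation π of [m] is represented by its word π(1) ⋯ π(m), a list of naturals.
-- IsPerm m w : w is a rearrangement of [1, 2, …, m].
IsPerm : ℕ → List ℕ → Set
IsPerm m w = w ↭ map suc (upTo m)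

-- at w i = π(i) (1-based); 0 when out of range.
at : List ℕ → ℕ → ℕ
at []       _             = 0
at (x ∷ xs) zero          = 0
at (x ∷ xs) (suc zero)    = x
at (x ∷ xs) (suc (suc i)) = at xs (suc i)

-- pos x w = π⁻¹(x) (1-based index of the first occurrence of x; length+1 if absent).
pos : ℕ → List ℕ → ℕ
pos x []       = 1
pos x (y ∷ ys) = if x ≡ᵇ y then 1 else suc (pos x ys)

des : List ℕ → ℕ
des []           = 0
des (x ∷ [])     = 0
des (x ∷ y ∷ r) = (if y <ᵇ x then 1 else 0) + des (y ∷ r)

InQ : ℕ → List ℕ → Set
InQ m w = IsPerm m w × Linked _<_ (take (pos m w) w)

RDbar : ℕ → ℕ → List ℕ → Set
RDbar n k w =
  InQ (n + 2) w × des w ≡ k ×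
  (pos 1 w ≡ n + 2 ⊎
   (2 ≤ pos 1 w × pos 1 w ≤ n + 1 × at w (pos 1 w ∸ 1) < at w (suc (pos 1 w))))

-- [σ , i] ∈ RHD_{n+1,k-1}   (des σ = k-1 written as des σ + 1 = k;
--  i ∈ {1,…,n-k+2} written 1 ≤ i ≤ (n+2) ∸ k, which is empty when k > n+2)
RHD : ℕ → ℕ → List ℕ × ℕ → Set
RHD n k (σ , i) =
  InQ (n + 1) σ × des σ + 1 ≡ k ×
  1 ≤ i × i ≤ (n + 2) ∸ k × pos (n + 1) σ ∸ 1 < i

-- The sets as setoids: elements are equal when their underlying data
-- (word, resp. pair [σ , i]) are equal (membership proofs are irrelevant).
RDbarSetoid : ℕ → ℕ → Setoid _ _
RDbarSetoid n k = On.setoid (P.setoid (List ℕ)) (proj₁ {B = RDbar n k})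

RHDSetoid : ℕ → ℕ → Setoid _ _
RHDSetoid n k = On.setoid (P.setoid (List ℕ × ℕ)) (proj₁ {B = RHD n k})

-- Deleting the letter 1 from π and lowering the remaining letters gives σ; what is lost is
-- where 1 was. Number the gaps of a word: first the gaps right after each ascent top
-- x < y, in order, then the end of the word. The condition on a = π⁻¹(1) says precisely
-- that 1 is not first and sits in one of these gaps, so π is recovered by inserting 1 into
-- gap i - 1 of σ + 1, where i - 1 is the number of ascents of π before its 1. Such an
-- insertion creates exactly one descent, so des σ = k - 1, and a word of length n + 1 with
-- distinct letters has asc + des = n, hence n - k + 2 gaps. Finally 1, being the least
-- letter and not the first, cannot lie in the increasing run π(1) < ⋯ < π(π⁻¹(n+2)); this
-- is the condition i > σ⁻¹(n+1) - 1, and an insertion into such a gap leaves the run intact.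

module Submission where

open import Defs
open import Data.Nat using (ℕ; zero; suc; pred; _+_; _∸_; _≤_; _<_; _≮_; _≡ᵇ_; _<ᵇ_; z≤n; s≤s; _≟_; _<?_)
open import Data.Nat.Properties
open import Data.Bool using (true; false; if_then_else_)
open import Data.List using (List; []; _∷_; take; map; upTo; length)
open import Data.List.Properties
  using (take-map; map-upTo; length-map; length-upTo; map-∘; map-id; map-id-local)
open import Data.List.Relation.Unary.All as All using (All; []; _∷_)
import Data.List.Relation.Unary.All.Properties as Allₚ
open import Data.List.Relation.Unary.AllPairs using (_∷_)
open import Data.List.Relation.Unary.Linked as Linked using (Linked; _∷_)
import Data.List.Relation.Unary.Linked.Properties as Linkedₚ
open import Data.List.Relation.Unary.Unique.Propositional using (Unique)
import Data.List.Relation.Unary.Unique.Propositional.Properties as Uniqueₚ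
open import Data.List.Relation.Binary.Permutation.Propositional
  using (_↭_; ↭-refl; ↭-prep; ↭-swap; ↭-trans; ↭-sym; ↭⇒↭ₛ; module PermutationReasoning)
import Data.List.Relation.Binary.Permutation.Propositional.Properties as ↭ₚ
open import Data.Product using (_×_; _,_; proj₁; proj₂)
open import Data.Sum using (_⊎_; inj₁; inj₂)
open import Relation.Binary.PropositionalEquality
import Data.List.Relation.Binary.Permutation.Setoid.Properties (setoid ℕ) as ↭ₛ
open import Relation.Nullary using (yes; no; contradiction)
open import Function.Base using (_∘_)
open import Function.Bundles using (_⇔_; mk⇔; Equivalence; Bijection)
open import Function.Properties.Inverse using (Inverse⇒Bijection)

<ᵇ-true : ∀ {x y} → x < y → (x <ᵇ y) ≡ true
<ᵇ-true {x} {y} x<y with x <ᵇ y | <⇒<ᵇ x<y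
... | true | _ = refl

<ᵇ-false : ∀ {x y} → x ≮ y → (x <ᵇ y) ≡ false
<ᵇ-false {x} {y} x≮y with x <ᵇ y | <ᵇ⇒< x y
... | false | _   = refl
... | true  | x<y = contradiction (x<y _) x≮y

≡ᵇ-refl : ∀ x → (x ≡ᵇ x) ≡ true
≡ᵇ-refl x with x ≡ᵇ x | ≡⇒≡ᵇ x x refl
... | true | _ = refl

≡ᵇ-false : ∀ {x y} → x ≢ y → (x ≡ᵇ y) ≡ false
≡ᵇ-false {x} {y} x≢y with x ≡ᵇ y | ≡ᵇ⇒≡ x y
... | false | _   = refl
... | true  | x≡y = contradiction (x≡y _) x≢y

pos-there : ∀ {v x} r → v ≢ x → pos v (x ∷ r) ≡ suc (pos v r)
pos-there r v≢x rewrite ≡ᵇ-false v≢x = refl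

pos-positive : ∀ v w → 1 ≤ pos v w
pos-positive v []      = s≤s z≤n
pos-positive v (x ∷ w) with v ≡ᵇ x
... | true  = s≤s z≤n
... | false = s≤s z≤n

pos∸1<⇔pos≤ : ∀ v w {q} → (pos v w ∸ 1 < q) ⇔ (pos v w ≤ q)
pos∸1<⇔pos≤ v w with pos v w | pos-positive v w
... | suc p | _ = mk⇔ (λ le → le) (λ le → le)

prefixTo : ℕ → List ℕ → List ℕ
prefixTo m w = take (pos m w) w

IncreasingUpTo : ℕ → List ℕ → Set
IncreasingUpTo m w = Linked _<_ (prefixTo m w)

asc : List ℕ → ℕ
asc []          = 0
asc (x ∷ [])    = 0
asc (x ∷ y ∷ r) = (if x <ᵇ y then 1 else 0) + asc (y ∷ r)

asc+des≡length : ∀ {x} r → Unique (x ∷ r) → asc (x ∷ r) + des (x ∷ r) ≡ length r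
asc+des≡length []      _ = refl
asc+des≡length {x} (y ∷ r) ((x≢y ∷ _) ∷ u) with x <? y
... | yes x<y rewrite <ᵇ-true x<y | <ᵇ-false (<-asym x<y) = cong suc (asc+des≡length r u)
... | no  x≮y rewrite <ᵇ-false x≮y | <ᵇ-true (≤∧≢⇒< (≮⇒≥ x≮y) (≢-sym x≢y)) =
  trans (+-suc _ _) (cong suc (asc+des≡length r u))

asc<length : ∀ {x} r → Unique (x ∷ r) → asc (x ∷ r) < length (x ∷ r)
asc<length {x} r u = s≤s (subst (asc (x ∷ r) ≤_) (asc+des≡length r u) (m≤m+n _ _))

suc-asc≡ : ∀ n {w} → Unique w → length w ≡ n + 1 → suc (asc w) ≡ (n + 2) ∸ suc (des w)
suc-asc≡ n {[]}    _ len = contradiction (trans len (+-comm n 1)) λ ()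
suc-asc≡ n {x ∷ r} u len = begin
  suc (asc w)                    ≡⟨ sym (m+n∸n≡m (suc (asc w)) (des w)) ⟩
  suc (asc w + des w) ∸ des w    ≡⟨ cong (λ l → suc l ∸ des w) (asc+des≡length r u) ⟩
  length w ∸ des w               ≡⟨ cong (_∸ des w) len ⟩
  (n + 1) ∸ des w                ≡⟨ cong (_∸ suc (des w)) (sym (+-suc n 1)) ⟩
  (n + 2) ∸ suc (des w)          ∎
  where
  open ≡-Reasoning
  w = x ∷ r

-- insert1 g w puts 1 into gap g (counted from 0) of w, or at the end if w has fewer gaps;
-- insertAfter g x r is insert1 g (x ∷ r) without its first letter x, which never moves.
mutual
  insertAfter : ℕ → ℕ → List ℕ → List ℕ
  insertAfter _ _ []      = 1 ∷ []
  insertAfter g x (y ∷ r) = if x <ᵇ y then insertAtAscent g y r else y ∷ insertAfter g y r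

  insertAtAscent : ℕ → ℕ → List ℕ → List ℕ
  insertAtAscent zero    y r = 1 ∷ y ∷ r
  insertAtAscent (suc g) y r = y ∷ insertAfter g y r

insert1 : ℕ → List ℕ → List ℕ
insert1 _ []      = 1 ∷ []
insert1 g (x ∷ r) = x ∷ insertAfter g x r

delete1 : List ℕ → List ℕ
delete1 []      = []
delete1 (x ∷ r) = if 1 ≡ᵇ x then r else x ∷ delete1 r

gapOf1 : List ℕ → ℕ
gapOf1 []          = 0
gapOf1 (x ∷ [])    = 0
gapOf1 (x ∷ y ∷ r) = if 1 ≡ᵇ y then 0 else (if x <ᵇ y then 1 else 0) + gapOf1 (y ∷ r)

insertAfter-↭ : ∀ g x r → insertAfter g x r ↭ 1 ∷ r
insertAfter-↭ g x []      = ↭-refl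
insertAfter-↭ g x (y ∷ r) with x <ᵇ y | g
... | true  | zero   = ↭-refl
... | true  | suc g′ = ↭-trans (↭-prep y (insertAfter-↭ g′ y r)) (↭-swap y 1 ↭-refl)
... | false | g′     = ↭-trans (↭-prep y (insertAfter-↭ g′ y r)) (↭-swap y 1 ↭-refl)

insert1-↭ : ∀ g w → insert1 g w ↭ 1 ∷ w
insert1-↭ g []      = ↭-refl
insert1-↭ g (x ∷ r) = ↭-trans (↭-prep x (insertAfter-↭ g x r)) (↭-swap x 1 ↭-refl)

delete1-insertAfter : ∀ g x {r} → All (1 <_) r → delete1 (insertAfter g x r) ≡ r
delete1-insertAfter g x {[]}    []         = refl
delete1-insertAfter g x {y ∷ r} (1<y ∷ ps) with x <ᵇ y | g
... | true  | zero   = refl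
... | true  | suc g′ rewrite ≡ᵇ-false (<⇒≢ 1<y) = cong (y ∷_) (delete1-insertAfter g′ y ps)
... | false | g′     rewrite ≡ᵇ-false (<⇒≢ 1<y) = cong (y ∷_) (delete1-insertAfter g′ y ps)

delete1-insert1 : ∀ g {w} → All (1 <_) w → delete1 (insert1 g w) ≡ w
delete1-insert1 g {[]}    []         = refl
delete1-insert1 g {x ∷ r} (1<x ∷ ps) rewrite ≡ᵇ-false (<⇒≢ 1<x) =
  cong (x ∷_) (delete1-insertAfter g x ps)

gapOf1-insertAfter : ∀ g x {r} → All (1 <_) r → g ≤ asc (x ∷ r) →
                     gapOf1 (x ∷ insertAfter g x r) ≡ g
gapOf1-insertAfter g x {[]}    []         z≤n = refl
gapOf1-insertAfter g x {y ∷ r} (1<y ∷ ps) g≤asc with x <ᵇ y in x<ᵇy | g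
... | true  | zero   = refl
... | true  | suc g′ rewrite x<ᵇy | ≡ᵇ-false (<⇒≢ 1<y) =
  cong suc (gapOf1-insertAfter g′ y ps (≤-pred g≤asc))
... | false | g′     rewrite x<ᵇy | ≡ᵇ-false (<⇒≢ 1<y) = gapOf1-insertAfter g′ y ps g≤asc

des-insertAfter : ∀ g {x r} → 1 < x → All (1 <_) r → des (x ∷ insertAfter g x r) ≡ suc (des (x ∷ r))
des-insertAfter g {x} {[]}    1<x [] rewrite <ᵇ-true 1<x = refl
des-insertAfter g {x} {y ∷ r} 1<x (1<y ∷ ps) with x <? y | g
... | yes x<y | zero
  rewrite <ᵇ-true x<y | <ᵇ-true 1<x | <ᵇ-false (<-asym 1<y) | <ᵇ-false (<-asym x<y) = refl
... | yes x<y | suc g′ rewrite <ᵇ-true x<y =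
  trans (cong ((if y <ᵇ x then 1 else 0) +_) (des-insertAfter g′ 1<y ps)) (+-suc _ _)
... | no x≮y  | g′     rewrite <ᵇ-false x≮y =
  trans (cong ((if y <ᵇ x then 1 else 0) +_) (des-insertAfter g′ 1<y ps)) (+-suc _ _)

-- Gap g lies at position at least g + 1, so the letters up to m are not moved.
mutual
  prefixTo-insert1 : ∀ m g x r → pos m (x ∷ r) ≤ suc g → pos m (x ∷ r) ≤ length (x ∷ r) →
                     prefixTo m (insert1 g (x ∷ r)) ≡ prefixTo m (x ∷ r)
  prefixTo-insert1 m g x r pos≤g pos≤len with m ≟ x
  ... | yes refl rewrite ≡ᵇ-refl m = refl
  ... | no m≢x   rewrite pos-there r m≢x | pos-there (insertAfter g x r) m≢x =
    cong (x ∷_) (prefixTo-insertAfter m g x r (≤-pred pos≤g) (≤-pred pos≤len))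

  prefixTo-insertAfter : ∀ m g x r → pos m r ≤ g → pos m r ≤ length r →
                         prefixTo m (insertAfter g x r) ≡ prefixTo m r
  prefixTo-insertAfter m g x (y ∷ r) pos≤g pos≤len with x <ᵇ y | g
  ... | true  | zero   = contradiction (≤-trans (pos-positive m (y ∷ r)) pos≤g) λ ()
  ... | true  | suc g′ = prefixTo-insert1 m g′ y r pos≤g pos≤len
  ... | false | g′     = prefixTo-insert1 m g′ y r (m≤n⇒m≤1+n pos≤g) pos≤len

-- For π = x ∷ r, the paper's condition on a = π⁻¹(1), recursively.
data OneInAscentGap (x : ℕ) : List ℕ → Set where
  last   : OneInAscentGap x (1 ∷ [])
  ascent : ∀ {z r} → x < z → OneInAscentGap x (1 ∷ z ∷ r)
  later  : ∀ {y r} → 1 ≢ y → OneInAscentGap y r → OneInAscentGap x (y ∷ r)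

oneInAscentGap-insertAfter : ∀ g x {r} → All (1 <_) r → OneInAscentGap x (insertAfter g x r)
oneInAscentGap-insertAfter g x {[]}    []         = last
oneInAscentGap-insertAfter g x {y ∷ r} (1<y ∷ ps) with x <? y | g
... | yes x<y | zero   rewrite <ᵇ-true x<y = ascent x<y
... | yes x<y | suc g′ rewrite <ᵇ-true x<y = later (<⇒≢ 1<y) (oneInAscentGap-insertAfter g′ y ps)
... | no x≮y  | g′     rewrite <ᵇ-false x≮y = later (<⇒≢ 1<y) (oneInAscentGap-insertAfter g′ y ps)

insertAfter-gapOf1 : ∀ {x r} → OneInAscentGap x r → insertAfter (gapOf1 (x ∷ r)) x (delete1 r) ≡ r
insertAfter-gapOf1 last = refl
insertAfter-gapOf1 (ascent x<z) rewrite <ᵇ-true x<z = refl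
insertAfter-gapOf1 {x} (later {y} 1≢y h) rewrite ≡ᵇ-false 1≢y with x <ᵇ y
... | true  = cong (y ∷_) (insertAfter-gapOf1 h)
... | false = cong (y ∷_) (insertAfter-gapOf1 h)

gapOf1≤asc : ∀ {x r} → OneInAscentGap x r → gapOf1 (x ∷ r) ≤ asc (x ∷ delete1 r)
gapOf1≤asc last       = z≤n
gapOf1≤asc (ascent _) = z≤n
gapOf1≤asc {x} (later {y} 1≢y h) rewrite ≡ᵇ-false 1≢y with x <ᵇ y
... | true  = s≤s (gapOf1≤asc h)
... | false = gapOf1≤asc h

linked-head : ∀ {x y r p} → 1 ≤ p → Linked _<_ (x ∷ take p (y ∷ r)) → x < y
linked-head (s≤s _) (x<y ∷ _) = x<y

-- 1 cannot lie in the increasing run ending at m: it would have to be its first letter.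
pos-delete1≤gapOf1 : ∀ {m x r} → 1 < x → m ≢ 1 → OneInAscentGap x r → IncreasingUpTo m (x ∷ r) →
                     pos m (x ∷ delete1 r) ≤ suc (gapOf1 (x ∷ r))
pos-delete1≤gapOf1 {m} {x} {r} 1<x m≢1 h incr with m ≟ x
... | yes refl rewrite ≡ᵇ-refl m = s≤s z≤n
... | no m≢x rewrite pos-there r m≢x | pos-there (delete1 r) m≢x = below h incr
  where
  x≮1 : x ≮ 1
  x≮1 = <-asym 1<x
  below : ∀ {r} → OneInAscentGap x r → Linked _<_ (x ∷ take (pos m r) r) →
          suc (pos m (delete1 r)) ≤ suc (gapOf1 (x ∷ r))
  below last incr rewrite pos-there [] m≢1 = contradiction (Linked.head incr) x≮1
  below (ascent {z} {r} _) incr rewrite pos-there (z ∷ r) m≢1 = contradiction (Linked.head incr) x≮1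
  below (later {y} {r} 1≢y h) incr with linked-head (pos-positive m (y ∷ r)) incr
  ... | x<y rewrite ≡ᵇ-false 1≢y | <ᵇ-true x<y =
    s≤s (pos-delete1≤gapOf1 (<-trans 1<x x<y) m≢1 h (Linked.tail incr))

AscentGapAt : List ℕ → ℕ → Set
AscentGapAt π a = 2 ≤ a × (a ≡ length π ⊎ (a < length π × at π (a ∸ 1) < at π (suc a)))

ascentGapAt-∷ : ∀ {x π a} → AscentGapAt π a → AscentGapAt (x ∷ π) (suc a)
ascentGapAt-∷ (2≤a@(s≤s (s≤s _)) , inj₁ a≡len)        = m≤n⇒m≤1+n 2≤a , inj₁ (cong suc a≡len)
ascentGapAt-∷ (2≤a@(s≤s (s≤s _)) , inj₂ (a<len , lt)) = m≤n⇒m≤1+n 2≤a , inj₂ (s≤s a<len , lt)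

ascentGapAt-∷⁻ : ∀ {x π a} → 2 ≤ a → AscentGapAt (x ∷ π) (suc a) → AscentGapAt π a
ascentGapAt-∷⁻ 2≤a@(s≤s (s≤s _)) (_ , inj₁ a≡len)        = 2≤a , inj₁ (suc-injective a≡len)
ascentGapAt-∷⁻ 2≤a@(s≤s (s≤s _)) (_ , inj₂ (a<len , lt)) = 2≤a , inj₂ (≤-pred a<len , lt)

oneInAscentGap⇒ascentGapAt : ∀ {x r} → OneInAscentGap x r → AscentGapAt (x ∷ r) (suc (pos 1 r))
oneInAscentGap⇒ascentGapAt last         = s≤s (s≤s z≤n) , inj₁ refl
oneInAscentGap⇒ascentGapAt (ascent x<z) = s≤s (s≤s z≤n) , inj₂ (s≤s (s≤s (s≤s z≤n)) , x<z)
oneInAscentGap⇒ascentGapAt (later {r = r} 1≢y h) rewrite pos-there r 1≢y =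
  ascentGapAt-∷ (oneInAscentGap⇒ascentGapAt h)

ascentGapAt⇒oneInAscentGap : ∀ {x} r → AscentGapAt (x ∷ r) (suc (pos 1 r)) → OneInAscentGap x r
ascentGapAt⇒oneInAscentGap []      (_ , inj₁ ())
ascentGapAt⇒oneInAscentGap []      (_ , inj₂ (s≤s () , _))
ascentGapAt⇒oneInAscentGap (y ∷ r) gap with 1 ≟ y
ascentGapAt⇒oneInAscentGap (1 ∷ [])    gap                  | yes refl = last
ascentGapAt⇒oneInAscentGap (1 ∷ z ∷ r) (_ , inj₁ ())        | yes refl
ascentGapAt⇒oneInAscentGap (1 ∷ z ∷ r) (_ , inj₂ (_ , x<z)) | yes refl = ascent x<z
ascentGapAt⇒oneInAscentGap (y ∷ r)     gap                  | no 1≢y rewrite pos-there r 1≢y =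
  later 1≢y (ascentGapAt⇒oneInAscentGap r (ascentGapAt-∷⁻ (s≤s (pos-positive 1 r)) gap))

ascentGapAt-pos1 : ∀ {x r} → AscentGapAt (x ∷ r) (pos 1 (x ∷ r)) → 1 ≢ x × OneInAscentGap x r
ascentGapAt-pos1 {x} {r} gap with 1 ≟ x
... | yes refl = contradiction (proj₁ gap) λ { (s≤s ()) }
... | no 1≢x rewrite pos-there r 1≢x = 1≢x , ascentGapAt⇒oneInAscentGap r gap

RDCondition : ℕ → List ℕ → ℕ → Set
RDCondition n π a = a ≡ n + 2 ⊎ (2 ≤ a × a ≤ n + 1 × at π (a ∸ 1) < at π (suc a))

rdCondition⇒ascentGapAt : ∀ {n π a} → length π ≡ n + 2 → RDCondition n π a → AscentGapAt π a
rdCondition⇒ascentGapAt {n} len (inj₁ a≡n+2) =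
  subst (2 ≤_) (sym a≡n+2) (m≤n+m 2 n) , inj₁ (trans a≡n+2 (sym len))
rdCondition⇒ascentGapAt {n} len (inj₂ (2≤a , a≤n+1 , lt)) =
  2≤a , inj₂ (subst (_ <_) (sym (trans len (+-suc n 1))) (s≤s a≤n+1) , lt)

ascentGapAt⇒rdCondition : ∀ {n π a} → length π ≡ n + 2 → AscentGapAt π a → RDCondition n π a
ascentGapAt⇒rdCondition {n} len (_ , inj₁ a≡len) = inj₁ (trans a≡len len)
ascentGapAt⇒rdCondition {n} len (2≤a , inj₂ (a<len , lt)) =
  inj₂ (2≤a , ≤-pred (subst (_ <_) (trans len (+-suc n 1)) a<len) , lt)

des-map-suc : ∀ σ → des (map suc σ) ≡ des σ
des-map-suc []          = refl
des-map-suc (x ∷ [])    = refl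
des-map-suc (x ∷ y ∷ σ) = cong ((if y <ᵇ x then 1 else 0) +_) (des-map-suc (y ∷ σ))

pos-map-suc : ∀ v σ → pos (suc v) (map suc σ) ≡ pos v σ
pos-map-suc v []      = refl
pos-map-suc v (y ∷ σ) = cong (if v ≡ᵇ y then 1 else_) (cong suc (pos-map-suc v σ))

prefixTo-map-suc : ∀ v σ → prefixTo (suc v) (map suc σ) ≡ map suc (prefixTo v σ)
prefixTo-map-suc v σ = trans (cong (λ p → take p (map suc σ)) (pos-map-suc v σ)) (take-map (pos v σ) σ)

increasingUpTo-map-suc : ∀ v σ → IncreasingUpTo v σ ⇔ IncreasingUpTo (suc v) (map suc σ)
increasingUpTo-map-suc v σ = mk⇔
  (λ incr → subst (Linked _<_) (sym (prefixTo-map-suc v σ)) (Linkedₚ.map⁺ (Linked.map s≤s incr)))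
  (λ incr → Linked.map ≤-pred (Linkedₚ.map⁻ (subst (Linked _<_) (prefixTo-map-suc v σ) incr)))

n+2≢1 : ∀ n → n + 2 ≢ 1
n+2≢1 n e = contradiction (trans (+-comm 2 n) e) λ ()

map-suc-upTo-n+2 : ∀ n → map suc (upTo (n + 2)) ≡ 1 ∷ map suc (map suc (upTo (n + 1)))
map-suc-upTo-n+2 n = trans (cong (λ m → map suc (upTo m)) (+-suc n 1))
                            (cong (λ l → 1 ∷ map suc l) (sym (map-upTo suc (n + 1))))

isPerm⇒length : ∀ {m w} → IsPerm m w → length w ≡ m
isPerm⇒length {m} p = trans (↭ₚ.↭-length p) (trans (length-map suc (upTo m)) (length-upTo m))

map-pred-suc : ∀ l → map pred (map suc l) ≡ l
map-pred-suc l = trans (sym (map-∘ l)) (map-id l)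

IsShiftedPerm : ℕ → List ℕ → Set
IsShiftedPerm m w = w ↭ map suc (map suc (upTo m))

isPerm⇒isShiftedPerm : ∀ {m σ} → IsPerm m σ → IsShiftedPerm m (map suc σ)
isPerm⇒isShiftedPerm = ↭ₚ.map⁺ suc

isShiftedPerm⇒All>1 : ∀ {m w} → IsShiftedPerm m w → All (1 <_) w
isShiftedPerm⇒All>1 {m} p =
  ↭ₚ.All-resp-↭ (↭-sym p) (Allₚ.map⁺ (Allₚ.map⁺ (All.universal (λ _ → s≤s (s≤s z≤n)) (upTo m))))

isShiftedPerm⇒Unique : ∀ {m w} → IsShiftedPerm m w → Unique w
isShiftedPerm⇒Unique {m} p =
  ↭ₛ.Unique-resp-↭ (↭⇒↭ₛ (↭-sym p))
    (Uniqueₚ.map⁺ suc-injective (Uniqueₚ.map⁺ suc-injective (Uniqueₚ.upTo⁺ m)))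

isShiftedPerm⇒isPerm : ∀ {m w} → IsShiftedPerm m w → IsPerm m (map pred w)
isShiftedPerm⇒isPerm {m} p = subst (_ ↭_) (map-pred-suc (map suc (upTo m))) (↭ₚ.map⁺ pred p)

isShiftedPerm⇒length : ∀ {m w} → IsShiftedPerm m w → length w ≡ m
isShiftedPerm⇒length {w = w} p = trans (sym (length-map pred w)) (isPerm⇒length (isShiftedPerm⇒isPerm p))

map-suc-pred : ∀ {m w} → IsShiftedPerm m w → map suc (map pred w) ≡ w
map-suc-pred {w = w} p = trans (sym (map-∘ w)) (map-id-local (All.map suc-pred-1< (isShiftedPerm⇒All>1 p)))
  where
  suc-pred-1< : ∀ {x} → 1 < x → suc (pred x) ≡ x
  suc-pred-1< (s≤s (s≤s _)) = refl

-- The paper numbers gaps from 1.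
compose : List ℕ × ℕ → List ℕ
compose (σ , i) = insert1 (pred i) (map suc σ)

decompose : List ℕ → List ℕ × ℕ
decompose π = map pred (delete1 π) , suc (gapOf1 π)

module Decomposition {n k x r} (perm : IsPerm (n + 2) (x ∷ r)) (incr : IncreasingUpTo (n + 2) (x ∷ r))
                     (des≡k : des (x ∷ r) ≡ k) (cond : RDCondition n (x ∷ r) (pos 1 (x ∷ r))) where

  1≢x×oneIn : 1 ≢ x × OneInAscentGap x r
  1≢x×oneIn = ascentGapAt-pos1 (rdCondition⇒ascentGapAt (isPerm⇒length perm) cond)

  1≢x : 1 ≢ x
  1≢x = proj₁ 1≢x×oneIn

  oneIn : OneInAscentGap x r
  oneIn = proj₂ 1≢x×oneIn

  W : List ℕ
  W = x ∷ delete1 r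

  g : ℕ
  g = gapOf1 (x ∷ r)

  σ : List ℕ
  σ = map pred W

  insert1-g-W : insert1 g W ≡ x ∷ r
  insert1-g-W = cong (x ∷_) (insertAfter-gapOf1 oneIn)

  shifted : IsShiftedPerm (n + 1) W
  shifted = ↭ₚ.drop-∷ (begin
    1 ∷ W                                  ↭⟨ insert1-↭ g W ⟨
    insert1 g W                            ≡⟨ insert1-g-W ⟩
    x ∷ r                                  ↭⟨ perm ⟩
    map suc (upTo (n + 2))                 ≡⟨ map-suc-upTo-n+2 n ⟩
    1 ∷ map suc (map suc (upTo (n + 1)))   ∎)
    where open PermutationReasoning

  map-suc-σ : map suc σ ≡ W
  map-suc-σ = map-suc-pred shifted

  all>1 : All (1 <_) W
  all>1 = isShiftedPerm⇒All>1 shifted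

  unique : Unique W
  unique = isShiftedPerm⇒Unique shifted

  k≡ : k ≡ suc (des W)
  k≡ = begin
    k                  ≡⟨ des≡k ⟨
    des (x ∷ r)        ≡⟨ cong des insert1-g-W ⟨
    des (insert1 g W)  ≡⟨ des-insertAfter g (All.head all>1) (All.tail all>1) ⟩
    suc (des W)        ∎
    where open ≡-Reasoning

  pos≤g : pos (n + 2) W ≤ suc g
  pos≤g = pos-delete1≤gapOf1 (All.head all>1) (n+2≢1 n) oneIn incr

  incrW : IncreasingUpTo (n + 2) W
  incrW = subst (Linked _<_) (prefixTo-insert1 (n + 2) g x (delete1 r) pos≤g pos≤len)
                (subst (IncreasingUpTo (n + 2)) (sym insert1-g-W) incr)
    where
    pos≤len : pos (n + 2) W ≤ length W
    pos≤len = ≤-trans pos≤g (s≤s (≤-trans (gapOf1≤asc oneIn) (≤-pred (asc<length (delete1 r) unique))))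

  incrσ : IncreasingUpTo (n + 1) σ
  incrσ = Equivalence.from (increasingUpTo-map-suc (n + 1) σ)
                           (subst₂ IncreasingUpTo (+-suc n 1) (sym map-suc-σ) incrW)

  desσ : des σ + 1 ≡ k
  desσ = begin
    des σ + 1              ≡⟨ +-comm (des σ) 1 ⟩
    suc (des σ)            ≡⟨ cong suc (des-map-suc σ) ⟨
    suc (des (map suc σ))  ≡⟨ cong (suc ∘ des) map-suc-σ ⟩
    suc (des W)            ≡⟨ k≡ ⟨
    k                      ∎
    where open ≡-Reasoning

  i≤ : suc g ≤ (n + 2) ∸ k
  i≤ = subst (suc g ≤_) gap-count (s≤s (gapOf1≤asc oneIn))
    where
    gap-count : suc (asc W) ≡ (n + 2) ∸ k
    gap-count = trans (suc-asc≡ n unique (isShiftedPerm⇒length shifted)) (cong ((n + 2) ∸_) (sym k≡))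

  pos< : pos (n + 1) σ ∸ 1 < suc g
  pos< = Equivalence.from (pos∸1<⇔pos≤ (n + 1) σ) (subst (_≤ suc g) pos-W pos≤g)
    where
    pos-W : pos (n + 2) W ≡ pos (n + 1) σ
    pos-W = trans (cong₂ pos (+-suc n 1) (sym map-suc-σ)) (pos-map-suc (n + 1) σ)

  rhd : RHD n k (σ , suc g)
  rhd = (isShiftedPerm⇒isPerm shifted , incrσ) , desσ , s≤s z≤n , i≤ , pos<

  compose-decompose : compose (σ , suc g) ≡ x ∷ r
  compose-decompose = trans (cong (insert1 g) map-suc-σ) insert1-g-W

module Composition {n k s σ g} (perm : IsPerm (n + 1) (s ∷ σ)) (incr : IncreasingUpTo (n + 1) (s ∷ σ))
                   (des≡k : des (s ∷ σ) + 1 ≡ k) (i≤ : suc g ≤ (n + 2) ∸ k)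
                   (pos< : pos (n + 1) (s ∷ σ) ∸ 1 < suc g) where

  W : List ℕ
  W = map suc (s ∷ σ)

  shifted : IsShiftedPerm (n + 1) W
  shifted = isPerm⇒isShiftedPerm perm

  all>1 : All (1 <_) W
  all>1 = isShiftedPerm⇒All>1 shifted

  unique : Unique W
  unique = isShiftedPerm⇒Unique shifted

  suc-desW : suc (des W) ≡ k
  suc-desW = trans (cong suc (des-map-suc (s ∷ σ))) (trans (+-comm 1 _) des≡k)

  g≤asc : g ≤ asc W
  g≤asc = ≤-pred (subst (suc g ≤_) (sym gap-count) i≤)
    where
    gap-count : suc (asc W) ≡ (n + 2) ∸ k
    gap-count = trans (suc-asc≡ n unique (isShiftedPerm⇒length shifted)) (cong ((n + 2) ∸_) suc-desW)

  pos≤g : pos (n + 2) W ≤ suc g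
  pos≤g = subst (_≤ suc g) pos-W (Equivalence.to (pos∸1<⇔pos≤ (n + 1) (s ∷ σ)) pos<)
    where
    pos-W : pos (n + 1) (s ∷ σ) ≡ pos (n + 2) W
    pos-W = trans (sym (pos-map-suc (n + 1) (s ∷ σ))) (cong (λ m → pos m W) (sym (+-suc n 1)))

  π : List ℕ
  π = insert1 g W

  permπ : IsPerm (n + 2) π
  permπ = begin
    insert1 g W                            ↭⟨ insert1-↭ g W ⟩
    1 ∷ W                                  <⟨ shifted ⟩
    1 ∷ map suc (map suc (upTo (n + 1)))   ≡⟨ map-suc-upTo-n+2 n ⟨
    map suc (upTo (n + 2))                 ∎
    where open PermutationReasoning

  incrπ : IncreasingUpTo (n + 2) π
  incrπ = subst (Linked _<_) (sym (prefixTo-insert1 (n + 2) g (suc s) (map suc σ) pos≤g pos≤len)) incrW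
    where
    incrW : IncreasingUpTo (n + 2) W
    incrW = subst (λ m → IncreasingUpTo m W) (sym (+-suc n 1))
                  (Equivalence.to (increasingUpTo-map-suc (n + 1) (s ∷ σ)) incr)
    pos≤len : pos (n + 2) W ≤ length W
    pos≤len = ≤-trans pos≤g (s≤s (≤-trans g≤asc (≤-pred (asc<length (map suc σ) unique))))

  desπ : des π ≡ k
  desπ = trans (des-insertAfter g (All.head all>1) (All.tail all>1)) suc-desW

  1≢suc-s : 1 ≢ suc s
  1≢suc-s = <⇒≢ (All.head all>1)

  condπ : RDCondition n π (pos 1 π)
  condπ = ascentGapAt⇒rdCondition (isPerm⇒length permπ)
            (subst (AscentGapAt π) (sym (pos-there (insertAfter g (suc s) (map suc σ)) 1≢suc-s))
                   (oneInAscentGap⇒ascentGapAt (oneInAscentGap-insertAfter g (suc s) (All.tail all>1))))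

  rdbar : RDbar n k π
  rdbar = (permπ , incrπ) , desπ , condπ

  decompose-compose : decompose π ≡ (s ∷ σ , suc g)
  decompose-compose = cong₂ _,_ (trans (cong (map pred) (delete1-insert1 g all>1)) (map-pred-suc (s ∷ σ)))
                                (cong suc (gapOf1-insertAfter g (suc s) (All.tail all>1) g≤asc))

decompose-RDbar : ∀ {n k} π → RDbar n k π → RHD n k (decompose π) × compose (decompose π) ≡ π
decompose-RDbar {n} []      ((perm , _) , _) = contradiction (trans (isPerm⇒length perm) (+-comm n 2)) λ ()
decompose-RDbar     (x ∷ r) ((perm , incr) , des≡k , cond)
  rewrite ≡ᵇ-false (Decomposition.1≢x perm incr des≡k cond) = D.rhd , D.compose-decompose
  where module D = Decomposition perm incr des≡k cond

compose-RHD : ∀ {n k} p → RHD n k p → RDbar n k (compose p) × decompose (compose p) ≡ p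
compose-RHD {n} ([] , i)        ((perm , _) , _)  =
  contradiction (trans (isPerm⇒length perm) (+-comm n 1)) λ ()
compose-RHD     (s ∷ σ , zero)  (_ , _ , () , _)
compose-RHD     (s ∷ σ , suc g) ((perm , incr) , des≡k , _ , i≤ , pos<) =
  C.rdbar , C.decompose-compose
  where module C = Composition perm incr des≡k i≤ pos<

lemma2p3 : (n k : ℕ) → Bijection (RDbarSetoid n k) (RHDSetoid n k)
lemma2p3 n k = Inverse⇒Bijection record
  { to        = λ (π , H) → decompose π , proj₁ (decompose-RDbar π H)
  ; from      = λ (p , H) → compose p , proj₁ (compose-RHD p H)
  ; to-cong   = cong decompose
  ; from-cong = cong compose
  ; inverse   = (λ {(p , H)} e → trans (cong decompose e) (proj₂ (compose-RHD p H)))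
              , (λ {(π , H)} e → trans (cong compose e) (proj₂ (decompose-RDbar π H)))
  }
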